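{- Let $M$ be a non-oriented map, $E$ one of its edges, and $M_1:=M\setminus E$. Assume $M_1$ is a top-degree map (respectively, an orientable map). If $E$ is a bridge or a leaf in $M$, then $M$ is a top-degree map (respectively, an orientable map). If $E$ is neither a bridge nor a leaf in $M$, then exactly one of the two maps $M$ and $\operatorname{twist}_E(M)$ is a top-degree map (respectively, an orientable map).
   Context: A non-oriented map is a triple $(\mathcal{B},\mathcal{W},\mathcal{E})$ of pairings (partitions into $2$-element blocks) of a finite set $X$ of edge-sides; geometrically, the pairs of $\mathcal{B}\cup\mathcal{W}$ form polygons (faces) whose sides are the elements of $X$, black vertices corresponding to pairs of $\mathcal{B}$ and white to pairs of $\mathcal{W}$ at corners, and gluing the polygon sides according to $\mathcal{E}$ yields a bicolored graph on a closed (possibly disconnected, possibly non-orientable) surface; edges of the map are the pairs of $\mathcal{E}$. It is equivalently a ribbon graph. $M\setminus E$ is the map obtained by deleting the edge (ribbon) $E$ and any vertex that becomes isolated. A map is orientable if its surface is orientable; it is top-degree if each connected component has exactly one face. A bridge is an edge whose removal increases the number of connected components; a leaf is an edge with an endpoint of degree $1$. For an edge $E=\{a,b\}\in\mathcal{E}$, $\operatorname{twist}_E(M)=(\mathcal{B},\mathcal{W}',\mathcal{E})$ where $\mathcal{W}'$ is obtained from $\mathcal{W}$ by exchanging the labels $a$ and $b$ (i.e. $\mathcal{W}'$ is the image of $\mathcal{W}$ under the transposition of $a$ and $b$); geometrically this twists the ribbon $E$ by a half-turn. -}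

module Defs where

open import Data.Bool using (Bool)
open import Data.Product using (Σ; Σ-syntax; ∃; ∃-syntax; _×_; _,_; proj₁; proj₂)
open import Data.Sum using (_⊎_; inj₁; inj₂)
open import Relation.Nullary using (¬_; Dec; yes; no)
open import Relation.Nullary.Decidable using (False; fromWitnessFalse; toWitnessFalse)
open import Relation.Binary.PropositionalEquality
open import Relation.Binary.Definitions using (DecidableEquality)

-- Pairings of a set X, represented as fixed-point-free involutions
-- (x is paired with π x).

IsPairing : {X : Set} → (X → X) → Set
IsPairing {X} π = (∀ x → π (π x) ≡ x) × (∀ x → π x ≢ x)

-- A non-oriented map (B , W , E) on the set of edge-sides X.
record Map (X : Set) : Set where
  constructor mkMap
  field
    B : X → X
    W : X → X
    E : X → X
open Map public

IsMap : {X : Set} → Map X → Set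
IsMap M = IsPairing (B M) × IsPairing (W M) × IsPairing (E M)

data Path {X : Set} (R : X → X → Set) : X → X → Set where
  here  : ∀ {x} → Path R x x
  there : ∀ {x y z} → R x y → Path R y z → Path R x z

FaceAdj : {X : Set} → Map X → X → X → Set
FaceAdj M x y = (y ≡ B M x) ⊎ (y ≡ W M x)

CompAdj : {X : Set} → Map X → X → X → Set
CompAdj M x y = (y ≡ B M x) ⊎ (y ≡ W M x) ⊎ (y ≡ E M x)

SameFace : {X : Set} → Map X → X → X → Set
SameFace M = Path (FaceAdj M)

SameComponent : {X : Set} → Map X → X → X → Set
SameComponent M = Path (CompAdj M)

-- top-degree: every connected component has exactly one face
TopDegree : {X : Set} → Map X → Set
TopDegree {X} M = ∀ (x y : X) → SameComponent M x y → SameFace M x y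

-- orientable: the polygons (faces) can be oriented coherently with the
-- gluing.  An orientation of the faces assigns to every side x the
-- direction s x (black-to-white or white-to-black) in which it is
-- traversed; sides meeting at a corner (a pair of B or W) are traversed
-- in opposite such directions, and sides glued by E must be traversed
-- in opposite directions for the gluing to be orientation-reversing.
Orientable : {X : Set} → Map X → Set
Orientable {X} M =
  Σ[ s ∈ (X → Bool) ] (∀ (x : X) →
    (s (B M x) ≢ s x) × (s (W M x) ≢ s x) × (s (E M x) ≢ s x))

module EdgeOps {X : Set} (_≟_ : DecidableEquality X) (M : Map X) (a : X) where

  b : X
  b = E M a

  Rest : Set
  Rest = Σ[ x ∈ X ] (False (x ≟ a) × False (x ≟ b))

  -- the pairing obtained from P by removing a and b:
  -- {x , a} , {b , y} ∈ P  become  {x , y};  {a , b} ∈ P is dropped.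
  contract : (X → X) → X → X
  contract P x with P x ≟ a | P x ≟ b
  ... | yes _ | _     = P b
  ... | no _  | yes _ = P a
  ... | no _  | no _  = P x

  contract-avoid : (P : X → X) → IsPairing P → (x : X) → x ≢ a → x ≢ b →
                   (contract P x ≢ a) × (contract P x ≢ b)
  contract-avoid P (inv , nf) x xa xb with P x ≟ a | P x ≟ b
  ... | yes e | _ =
        (λ pb≡a → xb (trans (sym (inv x)) (trans (cong P e)
                     (trans (cong P (sym pb≡a)) (inv b)))))
      , nf b
  ... | no _ | yes e =
        nf a
      , (λ pa≡b → xa (trans (sym (inv x)) (trans (cong P e)
                     (trans (cong P (sym pa≡b)) (inv a)))))
  ... | no n1 | no n2 = n1 , n2

  E-avoid : IsPairing (E M) → (x : X) → x ≢ a → x ≢ b →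
            (E M x ≢ a) × (E M x ≢ b)
  E-avoid (inv , nf) x xa xb =
      (λ e → xb (trans (sym (inv x)) (cong (E M) e)))
    , (λ e → xa (trans (sym (inv x)) (trans (cong (E M) e) (inv a))))

  restrict : (f : X → X) →
             ((x : X) → x ≢ a → x ≢ b → (f x ≢ a) × (f x ≢ b)) →
             Rest → Rest
  restrict f av (x , p , q) =
    f x , fromWitnessFalse (proj₁ (av x (toWitnessFalse p) (toWitnessFalse q)))
        , fromWitnessFalse (proj₂ (av x (toWitnessFalse p) (toWitnessFalse q)))

  -- M ∖ E  (vertices that become isolated disappear automatically,
  -- since a vertex is an orbit of edge-sides)
  delete : IsMap M → Map Rest
  delete (pB , pW , pE) = mkMap
    (restrict (contract (B M)) (contract-avoid (B M) pB))
    (restrict (contract (W M)) (contract-avoid (W M) pW))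
    (restrict (E M) (E-avoid pE))

  swap : X → X
  swap x with x ≟ a | x ≟ b
  ... | yes _ | _     = b
  ... | no _  | yes _ = a
  ... | no _  | no _  = x

  twist : Map X
  twist = mkMap (B M) (λ x → swap (W M (swap x))) (E M)

  -- E is a bridge: its removal increases the number of connected
  -- components, i.e. the component of M containing E splits in M ∖ E
  -- (all other components are unchanged).
  IsBridge : IsMap M → Set
  IsBridge h = Σ[ x ∈ Rest ] Σ[ y ∈ Rest ]
    (SameComponent M (proj₁ x) (proj₁ y) × ¬ SameComponent (delete h) x y)

  -- E is a leaf: its black endpoint (B∪E-orbit of a) or its white
  -- endpoint (W∪E-orbit of a) has degree 1, i.e. is the orbit {a , b}.
  IsLeaf : Set
  IsLeaf = (B M a ≡ b) ⊎ (W M a ≡ b)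

ExactlyOne : Set → Set → Set
ExactlyOne P Q = (P × ¬ Q) ⊎ (¬ P × Q)

module Submission where

-- Let b = E a and let p = B a, q = B b, r = W a, t = W b be the sides at the corners of the
-- edge.  Deleting the edge pairs p with q and r with t; M and twist M are the two ways of
-- gluing a and b back, with a joined to r, respectively to t.  If a and b lie on one face of
-- such a regluing, every face of M ∖ E lies inside a face of it, so a top-degree M ∖ E makes
-- it top-degree.  When E is not a leaf, walk the face of M from a through p until it returns
-- to the edge: the last side before the edge is q, r or t.  For q, the faces of M ∖ E through
-- p and r differ, so E is a bridge if M ∖ E is top-degree, and a, b share a face of M.  For r
-- (respectively t) the face closes up without b in M (respectively twist M) and reaches b in
-- the other map, while p and r share a face of M ∖ E, so E is no bridge.
-- An orientation s of M ∖ E extends to M if s p = s r and to twist M if s p = s t = not (s r).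
-- Across a bridge s may be flipped on the component of r; and orientations of both M and
-- twist M would have an xor that is constant on components of M ∖ E yet differs at p and r.

open import Defs
open import Data.Bool using (Bool; true; false; not; _xor_; if_then_else_)
open import Data.Bool.Properties using (T-irrelevant; not-distribʳ-xor; not-¬; ¬-not; not-involutive; xor-annihilates-not; not-injective) renaming (_≟_ to _≟ᵇ_)
open import Data.Empty using (⊥-elim)
open import Data.Fin using (Fin; _≟_; toℕ)
open import Data.Fin.Properties using (any?; pigeonhole)
open import Data.Fin.Subset using (Subset; ⊤; _-_; ∣_∣) renaming (_∈_ to _∈ˢ_)
open import Data.Fin.Subset.Properties using (∈⊤; x∈p∧x≢y⇒x∈p-y; p─q⊆p; x∈p⇒∣p-x∣<∣p∣) renaming (_∈?_ to _∈ˢ?_)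
open import Data.Nat using (ℕ; zero; suc; _+_; _<_; _≤_; z≤n; s≤s)
open import Data.Nat.GeneralisedArithmetic using (fold; fold-+)
open import Data.Nat.Properties using (n<1+n; ≤-refl; <⇒≤; +-suc; <-≤-trans; m≤n⇒∃[o]m+o≡n; m≤n⇒m<n∨m≡n)
open import Data.Product using (∃-syntax; _×_; _,_; proj₁; proj₂)
open import Data.Product.Properties using (,-injectiveˡ)
open import Data.Sum using (_⊎_; inj₁; inj₂)
open import Function using (_∘_; id)
open import Relation.Nullary using (¬_; Dec; yes; no; does)
open import Relation.Nullary.Decidable using (fromWitnessFalse; toWitnessFalse; _⊎-dec_)
open import Relation.Binary.Definitions using (Decidable; DecidableEquality)
open import Relation.Binary.PropositionalEquality using (_≡_; _≢_; refl; sym; trans; cong; cong₂; subst; subst₂; module ≡-Reasoning)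

≢-≢⇒≡ : ∀ {x y z : Bool} → x ≢ y → y ≢ z → x ≡ z
≢-≢⇒≡ x≢y y≢z = trans (¬-not x≢y) (sym (¬-not (y≢z ∘ sym)))

≢-≢-≢⇒≢ : ∀ {w x y z : Bool} → w ≢ x → x ≢ y → y ≢ z → w ≢ z
≢-≢-≢⇒≢ w≢x x≢y y≢z w≡z = y≢z (trans (sym (≢-≢⇒≡ w≢x x≢y)) w≡z)

involution⇒injective : {X : Set} (P : X → X) → (∀ x → P (P x) ≡ x) → ∀ {x y} → P x ≡ P y → x ≡ y
involution⇒injective P inv {x} {y} eq = trans (sym (inv x)) (trans (cong P eq) (inv y))

involution-transpose : {X : Set} (P : X → X) → (∀ x → P (P x) ≡ x) → ∀ {x y} → P x ≡ y → x ≡ P y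
involution-transpose P inv {x} eq = trans (sym (inv x)) (cong P eq)

module _ {X : Set} {R : X → X → Set} where

  infixr 5 _◅◅_

  _◅◅_ : ∀ {x y z} → Path R x y → Path R y z → Path R x z
  here      ◅◅ q = q
  there r p ◅◅ q = there r (p ◅◅ q)

  [_] : ∀ {x y} → R x y → Path R x y
  [ r ] = there r here

  reverse : (∀ {x y} → R x y → R y x) → ∀ {x y} → Path R x y → Path R y x
  reverse sym-R here        = here
  reverse sym-R (there r p) = reverse sym-R p ◅◅ [ sym-R r ]

  transport : (P : X → Set) → (∀ {x y} → R x y → P x → P y) →
              ∀ {x y} → Path R x y → P x → P y
  transport P step here        px = px
  transport P step (there r p) px = transport P step p (step r px)

pathMap : {X Y : Set} {R : X → X → Set} {S : Y → Y → Set} (f : X → Y) →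
          (∀ {x y} → R x y → Path S (f x) (f y)) →
          ∀ {x y} → Path R x y → Path S (f x) (f y)
pathMap f g here        = here
pathMap f g (there r p) = g r ◅◅ pathMap f g p

-- Reachability in finite graphs

module _ {X : Set} (_≟X_ : DecidableEquality X) {R : X → X → Set} where

  cut-loops : ∀ {v y} → Path R v y → Path (λ x z → R x z × z ≢ v) v y
  cut-loops {v} = go here
    where
    go : ∀ {x y} → Path (λ x z → R x z × z ≢ v) v x → Path R x y →
         Path (λ x z → R x z × z ≢ v) v y
    go acc here = acc
    go acc (there {y = z} r p) with z ≟X v
    ... | yes refl = go here p
    ... | no z≢v   = go (acc ◅◅ [ r , z≢v ]) p

module _ {n : ℕ} {R : Fin n → Fin n → Set} (R? : Decidable R) where

  Within : Subset n → Fin n → Fin n → Set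
  Within U = Path (λ x y → R x y × y ∈ˢ U)

  private
    widen : ∀ {U z y} → Within (U - z) z y → Within U z y
    widen {U} = pathMap id λ (r , m) → [ r , p─q⊆p U _ m ]

    narrow : ∀ {U z y} → Path (λ x w → (R x w × w ∈ˢ U) × w ≢ z) z y → Within (U - z) z y
    narrow = pathMap id λ ((r , m) , w≢z) → [ r , x∈p∧x≢y⇒x∈p-y m w≢z ]

  within? : ∀ fuel U → ∣ U ∣ < fuel → ∀ x y → Dec (Within U x y)
  via? : ∀ fuel U → ∣ U ∣ ≤ fuel → ∀ x y z → Dec (R x z × z ∈ˢ U × Within (U - z) z y)

  within? (suc fuel) U (s≤s bound) x y with x ≟ y | any? (via? fuel U bound x y)
  ... | yes refl | _                       = yes here
  ... | no _     | yes (z , r , z∈U , w)   = yes (there (r , z∈U) (widen w))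
  ... | no x≢y   | no ¬via                 = no λ
    { here → x≢y refl
    ; (there {y = z} (r , z∈U) w) → ¬via (z , r , z∈U , narrow (cut-loops _≟_ w)) }

  via? fuel U bound x y z with R? x z | z ∈ˢ? U
  ... | no ¬r | _      = no (¬r ∘ proj₁)
  ... | yes _ | no z∉U = no (z∉U ∘ proj₁ ∘ proj₂)
  ... | yes r | yes z∈U with within? fuel (U - z) (<-≤-trans (x∈p⇒∣p-x∣<∣p∣ z∈U) bound) z y
  ...   | yes w = yes (r , z∈U , w)
  ...   | no ¬w = no (¬w ∘ proj₂ ∘ proj₂)

  path? : Decidable (Path R)
  path? x y with within? (suc ∣ ⊤ {n} ∣) ⊤ (n<1+n _) x y
  ... | yes w = yes (pathMap id (λ (r , _) → [ r ]) w)
  ... | no ¬w = no (¬w ∘ pathMap id (λ r → [ r , ∈⊤ ]))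

-- Faces, components and orientations

module _ {X : Set} (N : Map X) where

  sameFace⇒sameComponent : ∀ {x y} → SameFace N x y → SameComponent N x y
  sameFace⇒sameComponent = pathMap id λ { (inj₁ e) → [ inj₁ e ] ; (inj₂ e) → [ inj₂ (inj₁ e) ] }

  edge-within-face : TopDegree N → ∀ x → SameFace N x (E N x)
  edge-within-face td x = td x (E N x) [ inj₂ (inj₂ refl) ]

  topDegree-if-edges-within-faces : (∀ x → SameFace N x (E N x)) → TopDegree N
  topDegree-if-edges-within-faces within x y = go
    where
    go : ∀ {x y} → SameComponent N x y → SameFace N x y
    go here                          = here
    go (there (inj₁ e) p)            = there (inj₁ e) (go p)
    go (there (inj₂ (inj₁ e)) p)     = there (inj₂ e) (go p)
    go (there (inj₂ (inj₂ refl)) p)  = within _ ◅◅ go p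

  IsOrientation : (X → Bool) → Set
  IsOrientation s = ∀ x → (s (B N x) ≢ s x) × (s (W N x) ≢ s x) × (s (E N x) ≢ s x)

  xor-constant-on-components : ∀ {s₁ s₂} → IsOrientation s₁ → IsOrientation s₂ →
    ∀ {x y} → SameComponent N x y → s₁ y xor s₂ y ≡ s₁ x xor s₂ x
  xor-constant-on-components {s₁} {s₂} o₁ o₂ {x} p =
    transport (λ y → s₁ y xor s₂ y ≡ s₁ x xor s₂ x) step p refl
    where
    flips : ∀ {u v} → s₁ v ≢ s₁ u → s₂ v ≢ s₂ u → s₁ v xor s₂ v ≡ s₁ u xor s₂ u
    flips {u} ne₁ ne₂ = trans (cong₂ _xor_ (¬-not ne₁) (¬-not ne₂)) (xor-annihilates-not (s₁ u) (s₂ u))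
    step : ∀ {u v} → CompAdj N u v → s₁ u xor s₂ u ≡ s₁ x xor s₂ x → s₁ v xor s₂ v ≡ s₁ x xor s₂ x
    step {u} (inj₁ refl)          = trans (flips (proj₁ (o₁ u)) (proj₁ (o₂ u)))
    step {u} (inj₂ (inj₁ refl))   = trans (flips (proj₁ (proj₂ (o₁ u))) (proj₁ (proj₂ (o₂ u))))
    step {u} (inj₂ (inj₂ refl))   = trans (flips (proj₂ (proj₂ (o₁ u))) (proj₂ (proj₂ (o₂ u))))

module _ {X : Set} (N : Map X) (hN : IsMap N) where

  private
    B-inv = proj₁ (proj₁ hN)
    W-inv = proj₁ (proj₁ (proj₂ hN))
    E-inv = proj₁ (proj₂ (proj₂ hN))

  faceAdj-sym : ∀ {x y} → FaceAdj N x y → FaceAdj N y x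
  faceAdj-sym {x} (inj₁ refl) = inj₁ (sym (B-inv x))
  faceAdj-sym {x} (inj₂ refl) = inj₂ (sym (W-inv x))

  compAdj-sym : ∀ {x y} → CompAdj N x y → CompAdj N y x
  compAdj-sym {x} (inj₁ refl)          = inj₁ (sym (B-inv x))
  compAdj-sym {x} (inj₂ (inj₁ refl))   = inj₂ (inj₁ (sym (W-inv x)))
  compAdj-sym {x} (inj₂ (inj₂ refl))   = inj₂ (inj₂ (sym (E-inv x)))

  sameFace-sym : ∀ {x y} → SameFace N x y → SameFace N y x
  sameFace-sym = reverse faceAdj-sym

  sameComponent-sym : ∀ {x y} → SameComponent N x y → SameComponent N y x
  sameComponent-sym = reverse compAdj-sym

  module Flip {S : X → Set} (S? : ∀ x → Dec (S x)) (closed : ∀ {x y} → CompAdj N x y → S x → S y) where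

    flipOn : (X → Bool) → X → Bool
    flipOn s x = if does (S? x) then not (s x) else s x

    flipOn-inside : ∀ {s x} → S x → flipOn s x ≡ not (s x)
    flipOn-inside {x = x} sx with S? x
    ... | yes _  = refl
    ... | no ¬sx = ⊥-elim (¬sx sx)

    flipOn-outside : ∀ {s x} → ¬ S x → flipOn s x ≡ s x
    flipOn-outside {x = x} ¬sx with S? x
    ... | yes sx = ⊥-elim (¬sx sx)
    ... | no _   = refl

    private
      flip-respects : (P : X → X) → (∀ x → P (P x) ≡ x) → (∀ {x} → S x → S (P x)) →
                      ∀ {s} x → s (P x) ≢ s x → flipOn s (P x) ≢ flipOn s x
      flip-respects P inv closedP x ne with S? x | S? (P x)
      ... | yes _  | yes _    = ne ∘ not-injective
      ... | no _   | no _     = ne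
      ... | yes sx | no ¬spx  = ⊥-elim (¬spx (closedP sx))
      ... | no ¬sx | yes spx  = ⊥-elim (¬sx (subst S (inv x) (closedP spx)))

    flip-orientation : ∀ {s} → IsOrientation N s → IsOrientation N (flipOn s)
    flip-orientation {s} o x =
        flip-respects (B N) B-inv (closed (inj₁ refl)) {s} x (proj₁ (o x))
      , flip-respects (W N) W-inv (closed (inj₂ (inj₁ refl))) {s} x (proj₁ (proj₂ (o x)))
      , flip-respects (E N) E-inv (closed (inj₂ (inj₂ refl))) {s} x (proj₂ (proj₂ (o x)))

-- Walking around a face

least-witness : {P : ℕ → Set} → (∀ i → Dec (P i)) → ∀ {m} → P m →
                ∃[ k ] P k × (∀ {i} → i < k → ¬ P i)
least-witness P? {m} pm with P? 0
... | yes p0 = 0 , p0 , λ ()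
least-witness P? {zero}  p0 | no ¬p0 = ⊥-elim (¬p0 p0)
least-witness P? {suc m} pm | no ¬p0 with least-witness (P? ∘ suc) pm
... | k , pk , below = suc k , pk , λ { {zero} _ → ¬p0 ; {suc i} (s≤s i<k) → below i<k }

fold-injective : {A : Set} {f : A → A} → (∀ {x y} → f x ≡ f y → x ≡ y) →
                 ∀ k {x y} → fold x f k ≡ fold y f k → x ≡ y
fold-injective f-injective zero    eq = eq
fold-injective f-injective (suc k) eq = fold-injective f-injective k (f-injective eq)

module _ {n : ℕ} {f : Fin n → Fin n} (f-injective : ∀ {x y} → f x ≡ f y → x ≡ y) where

  periodic : ∀ x → ∃[ d ] fold x f (suc d) ≡ x
  periodic x with pigeonhole (n<1+n n) (λ i → fold x f (toℕ i))
  ... | i , j , i<j , eq with m≤n⇒∃[o]m+o≡n i<j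
  ... | d , i+d≡j = d , sym (fold-injective f-injective (toℕ i) (begin
      fold x f (toℕ i)                    ≡⟨ eq ⟩
      fold x f (toℕ j)                    ≡⟨ cong (fold x f) (trans (sym i+d≡j) (sym (+-suc (toℕ i) d))) ⟩
      fold x f (toℕ i + suc d)            ≡⟨ fold-+ x f (toℕ i) ⟩
      fold (fold x f (suc d)) f (toℕ i)   ∎))
    where open ≡-Reasoning

-- A state (x , true) leaves x along Bf next and (x , false) along Wf, so iterating step walks
-- around a face.
module FaceWalk {X : Set} (Bf Wf : X → X) (hB : IsPairing Bf) (hW : IsPairing Wf) where

  step : X × Bool → X × Bool
  step (x , true)  = Bf x , false
  step (x , false) = Wf x , true

  walk : X × Bool → ℕ → X × Bool
  walk s k = fold s step k

  reversed : X × Bool → X × Bool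
  reversed (x , c) = x , not c

  step-injective : ∀ {s s′} → step s ≡ step s′ → s ≡ s′
  step-injective {x , true}  {y , true}  eq = cong (_, true) (involution⇒injective Bf (proj₁ hB) (,-injectiveˡ eq))
  step-injective {x , false} {y , false} eq = cong (_, false) (involution⇒injective Wf (proj₁ hW) (,-injectiveˡ eq))
  step-injective {_ , true}  {_ , false} ()
  step-injective {_ , false} {_ , true}  ()

  walk-shift : ∀ k s → walk (step s) k ≡ walk s (suc k)
  walk-shift zero    s = refl
  walk-shift (suc k) s = cong step (walk-shift k s)

  -- induction peels one step off each end, using step (reversed (step s)) ≡ reversed s
  walk-never-reverses : ∀ k s → walk s k ≢ reversed s
  walk-never-reverses zero          (x , true)  ()
  walk-never-reverses zero          (x , false) ()
  walk-never-reverses (suc zero)    (x , true)  eq = proj₂ hB x (,-injectiveˡ eq)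
  walk-never-reverses (suc zero)    (x , false) eq = proj₂ hW x (,-injectiveˡ eq)
  walk-never-reverses (suc (suc k)) s           eq =
    walk-never-reverses k (step s) (step-injective (trans (walk-shift (suc k) s) (trans eq (sym (turn s)))))
    where
    turn : ∀ s → step (reversed (step s)) ≡ reversed s
    turn (x , true)  = cong (_, false) (proj₁ hB x)
    turn (x , false) = cong (_, true) (proj₁ hW x)

  walk-returns : (∀ x → ∃[ d ] fold x (Wf ∘ Bf) (suc d) ≡ x) →
                 ∀ x → ∃[ k ] walk (step (x , true)) k ≡ (x , true)
  walk-returns returns x with returns x
  ... | d , eq = let k , reach = rounds d x in k , trans reach (cong (_, true) eq)
    where
    rounds : ∀ m x → ∃[ k ] walk (step (x , true)) k ≡ (fold x (Wf ∘ Bf) (suc m) , true)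
    rounds zero    x = 1 , refl
    rounds (suc m) x = let k , eq = rounds m x in suc (suc k) , cong (step ∘ step) eq

-- Deleting, regluing and twisting an edge

module Deletion {n : ℕ} (M : Map (Fin n)) (h : IsMap M) (a : Fin n) where

  open EdgeOps _≟_ M a public

  X : Set
  X = Fin n

  B-inv : ∀ x → B M (B M x) ≡ x
  B-inv = proj₁ (proj₁ h)

  W-inv : ∀ x → W M (W M x) ≡ x
  W-inv = proj₁ (proj₁ (proj₂ h))

  E-inv : ∀ x → E M (E M x) ≡ x
  E-inv = proj₁ (proj₂ (proj₂ h))

  B-transpose : ∀ {x y} → B M x ≡ y → x ≡ B M y
  B-transpose = involution-transpose (B M) B-inv

  W-transpose : ∀ {x y} → W M x ≡ y → x ≡ W M y
  W-transpose = involution-transpose (W M) W-inv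

  E-transpose : ∀ {x y} → E M x ≡ y → x ≡ E M y
  E-transpose = involution-transpose (E M) E-inv

  a≢b : a ≢ b
  a≢b e = proj₂ (proj₂ (proj₂ h)) a (sym e)

  mkRest : ∀ x → x ≢ a → x ≢ b → Rest
  mkRest x x≢a x≢b = x , fromWitnessFalse x≢a , fromWitnessFalse x≢b

  ≢a : (u : Rest) → proj₁ u ≢ a
  ≢a u = toWitnessFalse (proj₁ (proj₂ u))

  ≢b : (u : Rest) → proj₁ u ≢ b
  ≢b u = toWitnessFalse (proj₂ (proj₂ u))

  Rest-ext : ∀ {u v : Rest} → proj₁ u ≡ proj₁ v → u ≡ v
  Rest-ext {x , p , q} {.x , p′ , q′} refl = cong₂ (λ α β → x , α , β) (T-irrelevant p p′) (T-irrelevant q q′)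

  data View (x : X) : Set where
    is-a    : x ≡ a → View x
    is-b    : x ≡ b → View x
    in-rest : (u : Rest) → proj₁ u ≡ x → View x

  view : ∀ x → View x
  view x with x ≟ a | x ≟ b
  ... | yes x≡a | _       = is-a x≡a
  ... | no _    | yes x≡b = is-b x≡b
  ... | no x≢a  | no x≢b  = in-rest (mkRest x x≢a x≢b) refl

  contract-to-a : ∀ P {x} → P x ≡ a → contract P x ≡ P b
  contract-to-a P {x} e with P x ≟ a
  ... | yes _ = refl
  ... | no ne = ⊥-elim (ne e)

  contract-to-b : ∀ P {x} → P x ≡ b → contract P x ≡ P a
  contract-to-b P {x} e with P x ≟ a | P x ≟ b
  ... | yes e′ | _     = ⊥-elim (a≢b (trans (sym e′) e))
  ... | no _   | yes _ = refl
  ... | no _   | no ne = ⊥-elim (ne e)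

  contract-elsewhere : ∀ P {x} → P x ≢ a → P x ≢ b → contract P x ≡ P x
  contract-elsewhere P {x} ne₁ ne₂ with P x ≟ a | P x ≟ b
  ... | yes e | _     = ⊥-elim (ne₁ e)
  ... | no _  | yes e = ⊥-elim (ne₂ e)
  ... | no _  | no _  = refl

  contract-involutive : ∀ P → IsPairing P → ∀ x → x ≢ a → x ≢ b → contract P (contract P x) ≡ x
  contract-involutive P (inv , _) x x≢a x≢b with view (P x)
  ... | is-a e = trans (cong (contract P) (contract-to-a P e))
                   (trans (contract-to-b P (inv b)) (sym (involution-transpose P inv e)))
  ... | is-b e = trans (cong (contract P) (contract-to-b P e))
                   (trans (contract-to-a P (inv a)) (sym (involution-transpose P inv e)))
  ... | in-rest u e = trans (cong (contract P) (contract-elsewhere P (≢a u ∘ trans e) (≢b u ∘ trans e)))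
                   (trans (contract-elsewhere P (x≢a ∘ trans (sym (inv x))) (x≢b ∘ trans (sym (inv x)))) (inv x))

  contract-fixpoint-free : ∀ P → IsPairing P → ∀ x → contract P x ≢ x
  contract-fixpoint-free P (inv , fpf) x with view (P x)
  ... | is-a e = λ c → a≢b (sym (trans (involution-transpose P inv (trans (sym (contract-to-a P e)) c)) e))
  ... | is-b e = λ c → a≢b (trans (involution-transpose P inv (trans (sym (contract-to-b P e)) c)) e)
  ... | in-rest u e = λ c → fpf x (trans (sym (contract-elsewhere P (≢a u ∘ trans e) (≢b u ∘ trans e))) c)

  M∖E : Map Rest
  M∖E = delete h

  delete-isMap : IsMap M∖E
  delete-isMap = contracted (proj₁ h) , contracted (proj₁ (proj₂ h))
               , (λ u → Rest-ext (E-inv (proj₁ u))) , (λ u → proj₂ (proj₂ (proj₂ h)) (proj₁ u) ∘ cong proj₁)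
    where
    contracted : ∀ {P} (hP : IsPairing P) → IsPairing (restrict (contract P) (contract-avoid P hP))
    contracted {P} hP = (λ u → Rest-ext (contract-involutive P hP (proj₁ u) (≢a u) (≢b u)))
                      , (λ u → contract-fixpoint-free P hP (proj₁ u) ∘ cong proj₁)

  -- N is M (W′ = W M) or twist M (W′ = W twist); both have M ∖ E as deletion
  module Regluing (W′ : X → X) (W′-pairing : IsPairing W′)
                  (W′-contract : ∀ x → x ≢ a → x ≢ b → contract W′ x ≡ contract (W M) x) where

    N : Map X
    N = mkMap (B M) W′ (E M)

    N-isMap : IsMap N
    N-isMap = proj₁ h , W′-pairing , proj₂ (proj₂ h)

    contract-within-face : ∀ P → (∀ y → SameFace N y (P y)) → SameFace N a b →
                           ∀ x → SameFace N x (contract P x)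
    contract-within-face P adj ab x with P x ≟ a | P x ≟ b
    ... | yes e | _     = subst (SameFace N x) e (adj x) ◅◅ ab ◅◅ adj b
    ... | no _  | yes e = subst (SameFace N x) e (adj x) ◅◅ sameFace-sym N N-isMap ab ◅◅ adj a
    ... | no _  | no _  = adj x

    topDegree-regluing : SameFace N a b → TopDegree M∖E → TopDegree N
    topDegree-regluing ab td = topDegree-if-edges-within-faces N within
      where
      lift : ∀ {u v} → FaceAdj M∖E u v → SameFace N (proj₁ u) (proj₁ v)
      lift {u} (inj₁ refl) = contract-within-face (B M) (λ _ → [ inj₁ refl ]) ab (proj₁ u)
      lift {u} (inj₂ refl) = subst (SameFace N (proj₁ u)) (W′-contract (proj₁ u) (≢a u) (≢b u))
                               (contract-within-face W′ (λ _ → [ inj₂ refl ]) ab (proj₁ u))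
      within : ∀ x → SameFace N x (E M x)
      within x with view x
      ... | is-a refl      = ab
      ... | is-b refl      = subst (SameFace N b) (sym (E-inv a)) (sameFace-sym N N-isMap ab)
      ... | in-rest u refl = pathMap {R = FaceAdj M∖E} {S = FaceAdj N} proj₁ (λ {u} {v} → lift {u} {v}) (edge-within-face M∖E td u)

    contract-reverses : ∀ {s : X → Bool} P → (∀ x → s (P x) ≢ s x) → (∀ x → s (E M x) ≢ s x) →
                        ∀ x → s (contract P x) ≢ s x
    contract-reverses {s} P rev revE x with P x ≟ a | P x ≟ b
    ... | yes e | _     = ≢-≢-≢⇒≢ (rev b) (subst (λ y → s b ≢ s y) (sym e) (revE a)) (rev x)
    ... | no _  | yes e = ≢-≢-≢⇒≢ (rev a) (subst₂ (λ y z → s y ≢ s z) (E-inv a) (sym e) (revE b)) (rev x)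
    ... | no _  | no _  = rev x

    orientation-restricts : ∀ {s} → IsOrientation N s → IsOrientation M∖E (s ∘ proj₁)
    orientation-restricts {s} o u =
        contract-reverses (B M) (proj₁ ∘ o) revE (proj₁ u)
      , subst (λ y → s y ≢ s (proj₁ u)) (W′-contract (proj₁ u) (≢a u) (≢b u))
          (contract-reverses W′ (proj₁ ∘ proj₂ ∘ o) revE (proj₁ u))
      , revE (proj₁ u)
      where
      revE : ∀ x → s (E M x) ≢ s x
      revE = proj₂ ∘ proj₂ ∘ o

    Reverses : (X → X) → (Rest → Bool) → Set
    Reverses P s = ∀ u v → proj₁ v ≡ contract P (proj₁ u) → s v ≢ s u

    GluesAt : (X → X) → Bool → (Rest → Bool) → Set
    GluesAt P c s = (∀ u → proj₁ u ≡ P a → s u ≢ c) × (∀ u → proj₁ u ≡ P b → s u ≢ not c)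

    extend : Bool → (Rest → Bool) → X → Bool
    extend c s x with view x
    ... | is-a _      = c
    ... | is-b _      = not c
    ... | in-rest u _ = s u

    extend-reverses : ∀ P {c s} → IsPairing P → Reverses P s → GluesAt P c s →
                      ∀ x → extend c s (P x) ≢ extend c s x
    extend-reverses P {c} {s} (inv , fpf) rev (at-a , at-b) x with view x | view (P x)
    ... | is-a refl      | is-a e       = ⊥-elim (fpf a e)
    ... | is-a refl      | is-b _       = not-¬ refl ∘ sym
    ... | is-a refl      | in-rest v e  = at-a v e
    ... | is-b refl      | is-a _       = not-¬ refl
    ... | is-b refl      | is-b e       = ⊥-elim (fpf b e)
    ... | is-b refl      | in-rest v e  = at-b v e
    ... | in-rest u refl | is-a e       = at-a u (involution-transpose P inv e) ∘ sym
    ... | in-rest u refl | is-b e       = at-b u (involution-transpose P inv e) ∘ sym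
    ... | in-rest u refl | in-rest v e  =
      rev u v (trans e (sym (contract-elsewhere P (≢a v ∘ trans e) (≢b v ∘ trans e))))

    reverses-B : ∀ {s} → IsOrientation M∖E s → Reverses (B M) s
    reverses-B {s} o u v e = subst (λ w → s w ≢ s u) (Rest-ext (sym e)) (proj₁ (o u))

    reverses-W′ : ∀ {s} → IsOrientation M∖E s → Reverses W′ s
    reverses-W′ {s} o u v e =
      subst (λ w → s w ≢ s u) (Rest-ext (sym (trans e (W′-contract _ (≢a u) (≢b u))))) (proj₁ (proj₂ (o u)))

    reverses-E : ∀ {s} → IsOrientation M∖E s → Reverses (E M) s
    reverses-E {s} o u v e = subst (λ w → s w ≢ s u) (Rest-ext (sym (trans e (contract-elsewhere (E M)
        (≢b u ∘ E-transpose) (≢a u ∘ λ e → trans (E-transpose e) (E-inv a))))))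
      (proj₂ (proj₂ (o u)))

    glues-at-leaf : ∀ {P c s} → IsPairing P → P a ≡ b → GluesAt P c s
    glues-at-leaf {P} (inv , _) leaf = (λ u e → ⊥-elim (≢b u (trans e leaf)))
                                 , (λ u e → ⊥-elim (≢a u (trans e (sym (involution-transpose P inv leaf)))))

    glues-freely : ∀ {P s} (u₀ : Rest) → IsPairing P → Reverses P s → proj₁ u₀ ≡ P a →
                   GluesAt P (not (s u₀)) s
    glues-freely {P} {s} u₀ (inv , _) rev e₀ =
        (λ u e → subst (λ w → s w ≢ not (s u₀)) (Rest-ext (trans e₀ (sym e))) (not-¬ refl))
      , (λ u e → subst (s u ≢_) (sym (not-involutive _))
                   (rev u₀ u (trans e (sym (contract-to-a P (trans (cong P e₀) (inv a)))))))

    glues-at-some : ∀ {P s} → IsPairing P → Reverses P s → ∃[ c ] GluesAt P c s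
    glues-at-some {P} hP rev with P a ≟ b
    ... | yes leaf = true , glues-at-leaf hP leaf
    ... | no ¬leaf = _ , glues-freely (mkRest (P a) (proj₂ hP a) ¬leaf) hP rev refl

    orientation-extends : ∀ {c s} → IsOrientation M∖E s → GluesAt (B M) c s → GluesAt W′ c s →
                          Orientable N
    orientation-extends {c} {s} o glueB glueW = extend c s , λ x →
        extend-reverses (B M) (proj₁ h) (reverses-B o) glueB x
      , extend-reverses W′ W′-pairing (reverses-W′ o) glueW x
      , extend-reverses (E M) (proj₂ (proj₂ h)) (reverses-E o) (glues-at-leaf (proj₂ (proj₂ h)) refl) x

    orientable-regluing : ∀ {s} (p₀ w₀ : Rest) → proj₁ p₀ ≡ B M a → proj₁ w₀ ≡ W′ a → s p₀ ≡ s w₀ →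
                          IsOrientation M∖E s → Orientable N
    orientable-regluing {s} p₀ w₀ e₀ e₁ same o = orientation-extends o
      (glues-freely p₀ (proj₁ h) (reverses-B o) e₀)
      (subst (λ c → GluesAt W′ (not c) s) (sym same) (glues-freely w₀ W′-pairing (reverses-W′ o) e₁))

  swap-a : swap a ≡ b
  swap-a with a ≟ a
  ... | yes _ = refl
  ... | no ne = ⊥-elim (ne refl)

  swap-b : swap b ≡ a
  swap-b with b ≟ a | b ≟ b
  ... | yes e | _     = ⊥-elim (a≢b (sym e))
  ... | no _  | yes _ = refl
  ... | no _  | no ne = ⊥-elim (ne refl)

  swap-elsewhere : ∀ {x} → x ≢ a → x ≢ b → swap x ≡ x
  swap-elsewhere {x} x≢a x≢b with x ≟ a | x ≟ b
  ... | yes e | _     = ⊥-elim (x≢a e)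
  ... | no _  | yes e = ⊥-elim (x≢b e)
  ... | no _  | no _  = refl

  swap-involutive : ∀ x → swap (swap x) ≡ x
  swap-involutive x with view x
  ... | is-a refl      = trans (cong swap swap-a) swap-b
  ... | is-b refl      = trans (cong swap swap-b) swap-a
  ... | in-rest u refl = trans (cong swap (swap-elsewhere (≢a u) (≢b u))) (swap-elsewhere (≢a u) (≢b u))

  conjugate-pairing : ∀ {P} → IsPairing P → IsPairing (swap ∘ P ∘ swap)
  conjugate-pairing {P} (inv , fpf) =
      (λ x → trans (cong (swap ∘ P) (swap-involutive _))
               (trans (cong swap (inv (swap x))) (swap-involutive x)))
    , (λ x e → fpf (swap x) (trans (sym (swap-involutive _)) (cong swap e)))

  -- contracting the edge {a , b} forgets which of its two sides a pairing is glued to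
  contract-conjugate : ∀ P → IsPairing P → ∀ x → x ≢ a → x ≢ b → contract (swap ∘ P ∘ swap) x ≡ contract P x
  contract-conjugate P (inv , fpf) x x≢a x≢b with view (P x)
  ... | is-a e = begin
      contract (swap ∘ P ∘ swap) x  ≡⟨ contract-to-b (swap ∘ P ∘ swap) (trans (cong (swap ∘ P) sx) (trans (cong swap e) swap-a)) ⟩
      swap (P (swap a))             ≡⟨ cong (swap ∘ P) swap-a ⟩
      swap (P b)                    ≡⟨ swap-elsewhere (λ e′ → x≢b (trans (involution-transpose P inv e) (sym (involution-transpose P inv e′)))) (fpf b) ⟩
      P b                           ≡⟨ sym (contract-to-a P e) ⟩
      contract P x                  ∎
    where open ≡-Reasoning ; sx = swap-elsewhere x≢a x≢b
  ... | is-b e = begin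
      contract (swap ∘ P ∘ swap) x  ≡⟨ contract-to-a (swap ∘ P ∘ swap) (trans (cong (swap ∘ P) sx) (trans (cong swap e) swap-b)) ⟩
      swap (P (swap b))             ≡⟨ cong (swap ∘ P) swap-b ⟩
      swap (P a)                    ≡⟨ swap-elsewhere (fpf a) (λ e′ → x≢a (trans (involution-transpose P inv e) (sym (involution-transpose P inv e′)))) ⟩
      P a                           ≡⟨ sym (contract-to-b P e) ⟩
      contract P x                  ∎
    where open ≡-Reasoning ; sx = swap-elsewhere x≢a x≢b
  ... | in-rest u e = begin
      contract (swap ∘ P ∘ swap) x  ≡⟨ contract-elsewhere (swap ∘ P ∘ swap) (≢a u ∘ trans e ∘ trans (sym Pt)) (≢b u ∘ trans e ∘ trans (sym Pt)) ⟩
      swap (P (swap x))             ≡⟨ Pt ⟩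
      P x                           ≡⟨ sym (contract-elsewhere P (≢a u ∘ trans e) (≢b u ∘ trans e)) ⟩
      contract P x                  ∎
    where
    open ≡-Reasoning
    Pt : swap (P (swap x)) ≡ P x
    Pt = trans (cong (swap ∘ P) (swap-elsewhere x≢a x≢b)) (trans (cong swap (sym e)) (trans (swap-elsewhere (≢a u) (≢b u)) e))

  twist-agrees : ∀ {x} → x ≢ a → x ≢ b → W M x ≢ a → W M x ≢ b → W twist x ≡ W M x
  twist-agrees x≢a x≢b ne₁ ne₂ = trans (cong (swap ∘ W M) (swap-elsewhere x≢a x≢b)) (swap-elsewhere ne₁ ne₂)

  -- the adjacency of M ∖ E, read on all of Fin n so that path? applies
  DeletedAdj : X → X → Set
  DeletedAdj x y = y ≡ contract (B M) x ⊎ y ≡ contract (W M) x ⊎ y ≡ E M x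

  sameComponent? : ∀ u v → Dec (SameComponent M∖E u v)
  sameComponent? u v with path? (λ x y → (y ≟ contract (B M) x) ⊎-dec ((y ≟ contract (W M) x) ⊎-dec (y ≟ E M x)))
                                (proj₁ u) (proj₁ v)
  ... | yes uv = yes (lift u uv v refl)
    where
    lift : ∀ u {y} → Path DeletedAdj (proj₁ u) y → ∀ v → proj₁ v ≡ y → SameComponent M∖E u v
    lift u here                          v e = subst (SameComponent M∖E u) (Rest-ext (sym e)) here
    lift u (there (inj₁ refl) p)         v e = there (inj₁ refl) (lift (B M∖E u) p v e)
    lift u (there (inj₂ (inj₁ refl)) p)  v e = there (inj₂ (inj₁ refl)) (lift (W M∖E u) p v e)
    lift u (there (inj₂ (inj₂ refl)) p)  v e = there (inj₂ (inj₂ refl)) (lift (E M∖E u) p v e)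
  ... | no ¬uv = no (¬uv ∘ pathMap proj₁ λ
    { (inj₁ e) → [ inj₁ (cong proj₁ e) ] ; (inj₂ (inj₁ e)) → [ inj₂ (inj₁ (cong proj₁ e)) ]
    ; (inj₂ (inj₂ e)) → [ inj₂ (inj₂ (cong proj₁ e)) ] })

  module Untwisted = Regluing (W M) (proj₁ (proj₂ h)) (λ _ _ _ → refl)
  module Twisted = Regluing (W twist) (conjugate-pairing (proj₁ (proj₂ h)))
                                      (contract-conjugate (W M) (proj₁ (proj₂ h)))

  -- The face through a non-leaf edge

  module NonLeaf (¬leaf : ¬ IsLeaf) where

    p q r t : X
    p = B M a
    q = B M b
    r = W M a
    t = W M b

    p≢a : p ≢ a
    p≢a = proj₂ (proj₁ h) a

    p≢b : p ≢ b
    p≢b = ¬leaf ∘ inj₁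

    q≢a : q ≢ a
    q≢a = p≢b ∘ sym ∘ B-transpose

    q≢b : q ≢ b
    q≢b = proj₂ (proj₁ h) b

    r≢a : r ≢ a
    r≢a = proj₂ (proj₁ (proj₂ h)) a

    r≢b : r ≢ b
    r≢b = ¬leaf ∘ inj₂

    t≢a : t ≢ a
    t≢a = r≢b ∘ sym ∘ W-transpose

    t≢b : t ≢ b
    t≢b = proj₂ (proj₁ (proj₂ h)) b

    p′ q′ r′ t′ : Rest
    p′ = mkRest p p≢a p≢b
    q′ = mkRest q q≢a q≢b
    r′ = mkRest r r≢a r≢b
    t′ = mkRest t t≢a t≢b

    B∖E-p : B M∖E p′ ≡ q′
    B∖E-p = Rest-ext (contract-to-a (B M) (B-inv a))

    W∖E-r : W M∖E r′ ≡ t′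
    W∖E-r = Rest-ext (contract-to-a (W M) (W-inv a))

    W∖E-t : W M∖E t′ ≡ r′
    W∖E-t = Rest-ext (contract-to-b (W M) (W-inv b))

    twist-at-a : W twist a ≡ t
    twist-at-a = trans (cong (swap ∘ W M) swap-a) (swap-elsewhere t≢a t≢b)

    twist-at-b : W twist b ≡ r
    twist-at-b = trans (cong (swap ∘ W M) swap-b) (swap-elsewhere r≢a r≢b)

    twist-at-r : W twist r ≡ b
    twist-at-r = trans (cong (swap ∘ W M) (swap-elsewhere r≢a r≢b)) (trans (cong swap (W-inv a)) swap-a)

    twist-at-t : W twist t ≡ a
    twist-at-t = trans (cong (swap ∘ W M) (swap-elsewhere t≢a t≢b)) (trans (cong swap (W-inv b)) swap-b)

    open FaceWalk (B M) (W M) (proj₁ h) (proj₁ (proj₂ h))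

    AtEdge : X × Bool → Set
    AtEdge s = proj₁ s ≡ a ⊎ proj₁ s ≡ b

    at-edge? : ∀ s → Dec (AtEdge s)
    at-edge? s = (proj₁ s ≟ a) ⊎-dec (proj₁ s ≟ b)

    start : X × Bool
    start = p , false

    -- the walk from p (leaving along W) stays off the edge for k steps and then returns to it;
    -- abstract, since normalising this search makes type checking blow up
    abstract
      return-to-edge : ∃[ k ] AtEdge (walk start (suc k)) × (∀ {i} → i ≤ k → ¬ AtEdge (walk start i))
      return-to-edge
        with walk-returns (periodic {f = W M ∘ B M} (involution⇒injective (B M) B-inv ∘ involution⇒injective (W M) W-inv)) a
      ... | m , back with least-witness {P = AtEdge ∘ walk start} (at-edge? ∘ walk start) {m} (inj₁ (cong proj₁ back))
      ... | zero  , inj₁ e , _      = ⊥-elim (p≢a e)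
      ... | zero  , inj₂ e , _      = ⊥-elim (p≢b e)
      ... | suc k , hit    , before = k , hit , λ i≤k → before (s≤s i≤k)

    k : ℕ
    k = proj₁ return-to-edge

    stays : ∀ {i} → i ≤ k → ¬ AtEdge (walk start i)
    stays = proj₂ (proj₂ return-to-edge)

    leaving-for-edge : ∀ s → AtEdge (step s) →
                       s ≡ (p , true) ⊎ s ≡ (q , true) ⊎ s ≡ (r , false) ⊎ s ≡ (t , false)
    leaving-for-edge (x , true)  (inj₁ e) = inj₁ (cong (_, true) (B-transpose e))
    leaving-for-edge (x , true)  (inj₂ e) = inj₂ (inj₁ (cong (_, true) (B-transpose e)))
    leaving-for-edge (x , false) (inj₁ e) = inj₂ (inj₂ (inj₁ (cong (_, false) (W-transpose e))))
    leaving-for-edge (x , false) (inj₂ e) = inj₂ (inj₂ (inj₂ (cong (_, false) (W-transpose e))))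

    last-state : walk start k ≡ (q , true) ⊎ walk start k ≡ (r , false) ⊎ walk start k ≡ (t , false)
    last-state with leaving-for-edge (walk start k) (proj₁ (proj₂ return-to-edge))
    ... | inj₁ reversal = ⊥-elim (walk-never-reverses k start reversal)
    ... | inj₂ exits    = exits

    Visited : X → Set
    Visited x = ∃[ i ] i ≤ k × ∃[ c ] walk start i ≡ (x , c)

    visited-≢a : ∀ {x} → Visited x → x ≢ a
    visited-≢a (i , i≤k , _ , eq) x≡a = stays i≤k (inj₁ (trans (cong proj₁ eq) x≡a))

    visited-≢b : ∀ {x} → Visited x → x ≢ b
    visited-≢b (i , i≤k , _ , eq) x≡b = stays i≤k (inj₂ (trans (cong proj₁ eq) x≡b))

    visited-p : Visited p
    visited-p = 0 , z≤n , false , refl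

    visited-last : ∀ {x c} → walk start k ≡ (x , c) → Visited x
    visited-last {c = c} eq = k , ≤-refl , c , eq

    visited-B : ∀ {x} → Visited x → Visited (B M x) ⊎ B M x ≡ a ⊎ walk start k ≡ (x , true)
    visited-B (i , i≤k , true , eq) with m≤n⇒m<n∨m≡n i≤k
    ... | inj₁ i<k = inj₁ (suc i , i<k , false , cong step eq)
    ... | inj₂ refl = inj₂ (inj₂ eq)
    visited-B (zero , _ , false , refl) = inj₂ (inj₁ (B-inv a))
    visited-B {x} (suc i , i<k , false , eq) =
      inj₁ (i , <⇒≤ i<k , true , step-injective (trans eq (cong (_, false) (sym (B-inv x)))))

    visited-W : ∀ {x} → Visited x → Visited (W M x) ⊎ walk start k ≡ (x , false)
    visited-W (i , i≤k , false , eq) with m≤n⇒m<n∨m≡n i≤k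
    ... | inj₁ i<k = inj₁ (suc i , i<k , true , cong step eq)
    ... | inj₂ refl = inj₂ eq
    visited-W (zero , _ , true , ())
    visited-W {x} (suc i , i<k , true , eq) =
      inj₁ (i , <⇒≤ i<k , false , step-injective (trans eq (cong (_, true) (sym (W-inv x)))))

    module _ (W′ : X → X) (agrees : ∀ {x} → x ≢ a → x ≢ b → W M x ≢ a → W M x ≢ b → W′ x ≡ W M x) where

      private
        N : Map X
        N = mkMap (B M) W′ (E M)

        step-within-face : ∀ s → ¬ AtEdge s → ¬ AtEdge (step s) → FaceAdj N (proj₁ s) (proj₁ (step s))
        step-within-face (x , true)  _  _  = inj₁ refl
        step-within-face (x , false) n₁ n₂ = inj₂ (sym (agrees (n₁ ∘ inj₁) (n₁ ∘ inj₂) (n₂ ∘ inj₁) (n₂ ∘ inj₂)))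

      segment-within-face : ∀ {i} → i ≤ k → SameFace N p (proj₁ (walk start i))
      segment-within-face {zero}  _   = here
      segment-within-face {suc i} i<k = segment-within-face (<⇒≤ i<k)
        ◅◅ [ step-within-face (walk start i) (stays (<⇒≤ i<k)) (stays i<k) ]

      face-opens : ∀ {z c} → walk start k ≡ (z , c) → FaceAdj N z b → SameFace N a b
      face-opens last adj = [ inj₁ refl ] ◅◅ subst (SameFace N p) (cong proj₁ last) (segment-within-face ≤-refl) ◅◅ [ adj ]

      face-closes : ∀ {z} → walk start k ≡ (z , false) → W′ z ≡ a → W′ a ≡ z → ¬ SameFace N a b
      face-closes {z} last z↦a a↦z ab with transport Closed preserve ab (inj₁ refl)
        where
        Closed : X → Set
        Closed x = x ≡ a ⊎ Visited x
        preserve : ∀ {x y} → FaceAdj N x y → Closed x → Closed y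
        preserve (inj₁ refl) (inj₁ refl) = inj₂ visited-p
        preserve (inj₂ refl) (inj₁ refl) = inj₂ (subst Visited (sym a↦z) (visited-last last))
        preserve (inj₁ refl) (inj₂ v) with visited-B v
        ... | inj₁ v′          = inj₂ v′
        ... | inj₂ (inj₁ e)    = inj₁ e
        ... | inj₂ (inj₂ e) with trans (sym e) last
        ... | ()
        preserve (inj₂ refl) (inj₂ v) with visited-W v
        ... | inj₁ v′ = inj₂ (subst Visited (sym (agrees (visited-≢a v) (visited-≢b v) (visited-≢a v′) (visited-≢b v′))) v′)
        ... | inj₂ e  = inj₁ (trans (cong W′ (,-injectiveˡ (trans (sym e) last))) z↦a)
      ... | inj₁ b≡a = a≢b (sym b≡a)
      ... | inj₂ v   = visited-≢b v refl

    private
      step-within-deleted-face : ∀ s → ¬ AtEdge (step s) → ∀ u v → proj₁ u ≡ proj₁ s → proj₁ v ≡ proj₁ (step s) →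
                                 FaceAdj M∖E u v
      step-within-deleted-face (x , true)  n u v refl e =
        inj₁ (Rest-ext (trans e (sym (contract-elsewhere (B M) (n ∘ inj₁) (n ∘ inj₂)))))
      step-within-deleted-face (x , false) n u v refl e =
        inj₂ (Rest-ext (trans e (sym (contract-elsewhere (W M) (n ∘ inj₁) (n ∘ inj₂)))))

      segment-within-deleted-face : ∀ {i} → i ≤ k → ∀ u → proj₁ u ≡ proj₁ (walk start i) → SameFace M∖E p′ u
      segment-within-deleted-face {zero}  _   u e = subst (SameFace M∖E p′) (Rest-ext (sym e)) here
      segment-within-deleted-face {suc i} i<k v e = segment-within-deleted-face (<⇒≤ i<k) u refl
          ◅◅ [ step-within-deleted-face (walk start i) (stays i<k) u v refl e ]
        where
        u : Rest
        u = mkRest (proj₁ (walk start i)) (stays (<⇒≤ i<k) ∘ inj₁) (stays (<⇒≤ i<k) ∘ inj₂)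

    sides-share-face : walk start k ≡ (r , false) ⊎ walk start k ≡ (t , false) → SameFace M∖E p′ r′
    sides-share-face (inj₁ last) = segment-within-deleted-face ≤-refl r′ (sym (cong proj₁ last))
    sides-share-face (inj₂ last) = segment-within-deleted-face ≤-refl t′ (sym (cong proj₁ last))
      ◅◅ [ inj₂ (sym W∖E-t) ]

    sides-split-face : walk start k ≡ (q , true) → ¬ SameFace M∖E p′ r′
    sides-split-face last pr = r-unvisited (transport (Visited ∘ proj₁) (λ {u} {v} → preserve {u} {v}) pr visited-p)
      where
      preserve : ∀ {u v} → FaceAdj M∖E u v → Visited (proj₁ u) → Visited (proj₁ v)
      preserve (inj₁ refl) v with visited-B v
      ... | inj₁ v′       = subst Visited (sym (contract-elsewhere (B M) (visited-≢a v′) (visited-≢b v′))) v′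
      ... | inj₂ (inj₁ e) = subst Visited (sym (contract-to-a (B M) e)) (visited-last last)
      ... | inj₂ (inj₂ e) = subst Visited
              (sym (contract-to-b (B M) (trans (cong (B M) (,-injectiveˡ (trans (sym e) last))) (B-inv b)))) visited-p
      preserve (inj₂ refl) v with visited-W v
      ... | inj₁ v′ = subst Visited (sym (contract-elsewhere (W M) (visited-≢a v′) (visited-≢b v′))) v′
      ... | inj₂ e with trans (sym e) last
      ... | ()
      r-unvisited : ¬ Visited r
      r-unvisited (zero , _ , true , ())
      r-unvisited (suc i , i<k , true , eq) =
        stays (<⇒≤ i<k) (inj₁ (,-injectiveˡ (step-injective {walk start i} {a , false} eq)))
      r-unvisited (i , i≤k , false , eq) with m≤n⇒m<n∨m≡n i≤k
      ... | inj₁ i<k = stays i<k (inj₁ (trans (cong (proj₁ ∘ step) eq) (W-inv a)))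
      ... | inj₂ refl with trans (sym eq) last
      ... | ()

    sides-adjacent : SameComponent M p r
    sides-adjacent = there (inj₁ (sym (B-inv a))) [ inj₂ (inj₁ refl) ]

    bridge-if-sides-disconnected : ¬ SameComponent M∖E p′ r′ → IsBridge h
    bridge-if-sides-disconnected ¬pr = p′ , r′ , sides-adjacent , ¬pr

    project : X → Rest
    project x with view x
    ... | is-a _      = p′
    ... | is-b _      = q′
    ... | in-rest u _ = u

    project-rest : ∀ (u : Rest) {x} → proj₁ u ≡ x → project x ≡ u
    project-rest u {x} e with view x
    ... | is-a e′      = ⊥-elim (≢a u (trans e e′))
    ... | is-b e′      = ⊥-elim (≢b u (trans e e′))
    ... | in-rest v e′ = Rest-ext (trans e′ (sym e))

    -- once p′ and r′ are connected, all neighbours of the edge lie in the component K of p′,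
    -- so every step of M projects to a path of M∖E
    module _ (pr : SameComponent M∖E p′ r′) where

      private
        K : Rest → Set
        K = SameComponent M∖E p′

        K-project : ∀ (u : Rest) {x} → proj₁ u ≡ x → K u → K (project x)
        K-project u e = subst K (sym (project-rest u e))

        K-a : ∀ {x} → x ≡ a → K (project x)
        K-a {x} e with view x
        ... | is-a _       = here
        ... | is-b e′      = ⊥-elim (a≢b (trans (sym e) e′))
        ... | in-rest u e′ = ⊥-elim (≢a u (trans e′ e))

        K-b : ∀ {x} → x ≡ b → K (project x)
        K-b {x} e with view x
        ... | is-a e′      = ⊥-elim (a≢b (trans (sym e′) e))
        ... | is-b _       = [ inj₁ (sym B∖E-p) ]
        ... | in-rest u e′ = ⊥-elim (≢b u (trans e′ e))

        K-edge : ∀ {x} → x ≡ a ⊎ x ≡ b → K (project x)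
        K-edge (inj₁ e) = K-a e
        K-edge (inj₂ e) = K-b e

        K-neighbour : ∀ {x y} → x ≡ a ⊎ x ≡ b → CompAdj M x y → K (project y)
        K-neighbour (inj₁ refl) (inj₁ refl)        = K-project p′ refl here
        K-neighbour (inj₁ refl) (inj₂ (inj₁ refl)) = K-project r′ refl pr
        K-neighbour (inj₁ refl) (inj₂ (inj₂ refl)) = K-b refl
        K-neighbour (inj₂ refl) (inj₁ refl)        = K-project q′ refl [ inj₁ (sym B∖E-p) ]
        K-neighbour (inj₂ refl) (inj₂ (inj₁ refl)) = K-project t′ refl (pr ◅◅ [ inj₂ (inj₁ (sym W∖E-r)) ])
        K-neighbour (inj₂ refl) (inj₂ (inj₂ refl)) = K-a (E-inv a)

        through-K : ∀ {u v} → K u → K v → SameComponent M∖E u v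
        through-K ku kv = sameComponent-sym M∖E delete-isMap ku ◅◅ kv

        direct : ∀ {u v : Rest} → CompAdj M (proj₁ u) (proj₁ v) → CompAdj M∖E u v
        direct {u} {v} (inj₁ e) =
          inj₁ (Rest-ext (trans e (sym (contract-elsewhere (B M) (≢a v ∘ trans e) (≢b v ∘ trans e)))))
        direct {u} {v} (inj₂ (inj₁ e)) =
          inj₂ (inj₁ (Rest-ext (trans e (sym (contract-elsewhere (W M) (≢a v ∘ trans e) (≢b v ∘ trans e))))))
        direct (inj₂ (inj₂ e)) = inj₂ (inj₂ (Rest-ext e))

        by-cases : ∀ {x y} → View x → View y → CompAdj M x y → SameComponent M∖E (project x) (project y)
        by-cases (is-a e)         _            xy = through-K (K-edge (inj₁ e)) (K-neighbour (inj₁ e) xy)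
        by-cases (is-b e)         _            xy = through-K (K-edge (inj₂ e)) (K-neighbour (inj₂ e) xy)
        by-cases (in-rest _ _)    (is-a e)     xy = through-K (K-neighbour (inj₁ e) (compAdj-sym M h xy)) (K-edge (inj₁ e))
        by-cases (in-rest _ _)    (is-b e)     xy = through-K (K-neighbour (inj₂ e) (compAdj-sym M h xy)) (K-edge (inj₂ e))
        by-cases (in-rest u refl) (in-rest v refl) xy =
          subst₂ (SameComponent M∖E) (sym (project-rest u refl)) (sym (project-rest v refl)) [ direct {u} {v} xy ]

      project-step : ∀ {x y} → CompAdj M x y → SameComponent M∖E (project x) (project y)
      project-step {x} {y} = by-cases (view x) (view y)

      not-bridge-if-sides-connected : ¬ IsBridge h
      not-bridge-if-sides-connected (x , y , xy , ¬xy) =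
        ¬xy (subst₂ (SameComponent M∖E) (project-rest x refl) (project-rest y refl)
                    (pathMap project (λ {x} {y} → project-step {x} {y}) xy))

    topDegree-if-bridge : TopDegree M∖E → IsBridge h → TopDegree M
    topDegree-if-bridge td bridge with last-state
    ... | inj₁ last = Untwisted.topDegree-regluing (face-opens (W M) (λ _ _ _ _ → refl) last (inj₁ (sym (B-inv b)))) td
    ... | inj₂ last = ⊥-elim (not-bridge-if-sides-connected (sameFace⇒sameComponent M∖E (sides-share-face last)) bridge)

    topDegree-exactly-one : TopDegree M∖E → ¬ IsBridge h → ExactlyOne (TopDegree M) (TopDegree twist)
    topDegree-exactly-one td ¬bridge with last-state
    ... | inj₁ last        = ⊥-elim (¬bridge (bridge-if-sides-disconnected (sides-split-face last ∘ td p′ r′)))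
    ... | inj₂ (inj₁ last) =
      inj₂ ( face-closes (W M) (λ _ _ _ _ → refl) last (W-inv a) refl ∘ (λ tdM → edge-within-face M tdM a)
           , Twisted.topDegree-regluing (face-opens (W twist) twist-agrees last (inj₂ (sym twist-at-r))) td )
    ... | inj₂ (inj₂ last) =
      inj₁ ( Untwisted.topDegree-regluing (face-opens (W M) (λ _ _ _ _ → refl) last (inj₂ (sym (W-inv b)))) td
           , face-closes (W twist) twist-agrees last twist-at-t twist-at-a ∘ (λ tdT → edge-within-face twist tdT a) )

    -- M orients p and r alike and twist M oppositely, so the xor of the two orientations,
    -- constant on components of M ∖ E, separates p′ from r′
    bridge-if-both-orientable : Orientable M → Orientable twist → IsBridge h
    bridge-if-both-orientable (s₁ , o₁) (s₂ , o₂) = bridge-if-sides-disconnected λ pr → not-¬ refl (begin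
        s₁ p xor s₂ p        ≡⟨ sym (xor-constant-on-components M∖E (Untwisted.orientation-restricts o₁)
                                                                   (Twisted.orientation-restricts o₂) pr) ⟩
        s₁ r xor s₂ r        ≡⟨ cong₂ _xor_ (≢-≢⇒≡ (proj₁ (proj₂ (o₁ a))) (proj₁ (o₁ a) ∘ sym))
                                            (¬-not (≢-≢-≢⇒≢ r≠b b≠a (proj₁ (o₂ a) ∘ sym))) ⟩
        s₁ p xor not (s₂ p)  ≡⟨ sym (not-distribʳ-xor (s₁ p) (s₂ p)) ⟩
        not (s₁ p xor s₂ p)  ∎)
      where
      open ≡-Reasoning
      r≠b : s₂ r ≢ s₂ b
      r≠b = subst (λ y → s₂ y ≢ s₂ b) twist-at-b (proj₁ (proj₂ (o₂ b)))
      b≠a : s₂ b ≢ s₂ a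
      b≠a = proj₂ (proj₂ (o₂ a))

    orientable-if-bridge : Orientable M∖E → IsBridge h → Orientable M
    orientable-if-bridge (s , o) bridge with s p′ ≟ᵇ s r′
    ... | yes same = Untwisted.orientable-regluing p′ r′ refl refl same o
    ... | no differ = Untwisted.orientable-regluing p′ r′ refl refl same′ (flip-orientation o)
      where
      closed : ∀ {u v} → CompAdj M∖E u v → SameComponent M∖E r′ u → SameComponent M∖E r′ v
      closed uv ru = ru ◅◅ [ uv ]
      open Flip M∖E delete-isMap (sameComponent? r′) closed
      same′ : flipOn s p′ ≡ flipOn s r′
      same′ = begin
        flipOn s p′  ≡⟨ flipOn-outside {s} (λ rp → not-bridge-if-sides-connected (sameComponent-sym M∖E delete-isMap rp) bridge) ⟩
        s p′         ≡⟨ ¬-not differ ⟩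
        not (s r′)   ≡⟨ sym (flipOn-inside {s} here) ⟩
        flipOn s r′  ∎
        where open ≡-Reasoning

    orientable-exactly-one : Orientable M∖E → ¬ IsBridge h → ExactlyOne (Orientable M) (Orientable twist)
    orientable-exactly-one (s , o) ¬bridge with s p′ ≟ᵇ s r′
    ... | yes same = inj₁ (oM , ¬bridge ∘ bridge-if-both-orientable oM)
      where
      oM : Orientable M
      oM = Untwisted.orientable-regluing p′ r′ refl refl same o
    ... | no differ = inj₂ (¬bridge ∘ (λ oM → bridge-if-both-orientable oM oT) , oT)
      where
      t≠r : s t′ ≢ s r′
      t≠r = subst (λ w → s w ≢ s r′) W∖E-r (proj₁ (proj₂ (o r′)))
      oT : Orientable twist
      oT = Twisted.orientable-regluing p′ t′ refl (sym twist-at-a) (≢-≢⇒≡ differ (t≠r ∘ sym)) o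

  leaf? : Dec IsLeaf
  leaf? = (B M a ≟ b) ⊎-dec (W M a ≟ b)

  leaf-within-face : IsLeaf → SameFace M a b
  leaf-within-face (inj₁ leaf) = [ inj₁ (sym leaf) ]
  leaf-within-face (inj₂ leaf) = [ inj₂ (sym leaf) ]

  topDegree-if-bridge-or-leaf : TopDegree M∖E → IsBridge h ⊎ IsLeaf → TopDegree M
  topDegree-if-bridge-or-leaf td bridge-or-leaf with leaf? | bridge-or-leaf
  ... | yes leaf | _            = Untwisted.topDegree-regluing (leaf-within-face leaf) td
  ... | no ¬leaf | inj₁ bridge  = NonLeaf.topDegree-if-bridge ¬leaf td bridge
  ... | no ¬leaf | inj₂ leaf    = ⊥-elim (¬leaf leaf)

  orientable-if-leaf : Orientable M∖E → IsLeaf → Orientable M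
  orientable-if-leaf (s , o) (inj₁ leaf) =
    orientation-extends o (glues-at-leaf (proj₁ h) leaf) (proj₂ (glues-at-some (proj₁ (proj₂ h)) (reverses-W′ o)))
    where open Untwisted
  orientable-if-leaf (s , o) (inj₂ leaf) =
    orientation-extends o (proj₂ (glues-at-some (proj₁ h) (reverses-B o))) (glues-at-leaf (proj₁ (proj₂ h)) leaf)
    where open Untwisted

  orientable-if-bridge-or-leaf : Orientable M∖E → IsBridge h ⊎ IsLeaf → Orientable M
  orientable-if-bridge-or-leaf om bridge-or-leaf with leaf? | bridge-or-leaf
  ... | yes leaf | _            = orientable-if-leaf om leaf
  ... | no ¬leaf | inj₁ bridge  = NonLeaf.orientable-if-bridge ¬leaf om bridge
  ... | no ¬leaf | inj₂ leaf    = ⊥-elim (¬leaf leaf)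

lemma1p7 : (n : ℕ) (M : Map (Fin n)) (h : IsMap M) (a : Fin n) →
    let open EdgeOps _≟_ M a in
    ((TopDegree (delete h) → IsBridge h ⊎ IsLeaf → TopDegree M)
      × (TopDegree (delete h) → ¬ IsBridge h → ¬ IsLeaf →
           ExactlyOne (TopDegree M) (TopDegree twist)))
    × ((Orientable (delete h) → IsBridge h ⊎ IsLeaf → Orientable M)
      × (Orientable (delete h) → ¬ IsBridge h → ¬ IsLeaf →
           ExactlyOne (Orientable M) (Orientable twist)))
lemma1p7 n M h a =
    ( topDegree-if-bridge-or-leaf
    , λ td ¬bridge ¬leaf → NonLeaf.topDegree-exactly-one ¬leaf td ¬bridge )
  , ( orientable-if-bridge-or-leaf
    , λ om ¬bridge ¬leaf → NonLeaf.orientable-exactly-one ¬leaf om ¬bridge )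
  where open Deletion M h a
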